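{- In the two-stage matching problem with edge weights, the Greedy with Random Discard algorithm (see context) is $\frac12$-competitive against the optimum offline policy: on every instance its expected total matched edge weight is at least $\frac12\,\mathrm{OPT}_{\mathrm{offline}}$.
   Context: Edge-weighted two-stage stochastic matching: finite bipartite graph $G=(D,S,E)$, $D=D_1\cup D_2$ disjoint, edge weights $w_e\ge0$, probabilities $\pi_i$ ($i\in D_2$). The algorithm picks a matching $M_1$ of $G[D_1,S]$; each $i\in D_2$ is then available independently w.p. $\pi_i$ (random set $\tilde D_2$); the algorithm picks a matching $M_2$ between $\tilde D_2$ and supply vertices unmatched by $M_1$. Objective: $\mathbb{E}[\sum_{e\in M_1\cup M_2}w_e]$. $\mathrm{OPT}_{\mathrm{offline}}=\mathbb{E}_{\tilde D_2}[\text{maximum edge-weight of a matching of }G[D_1\cup\tilde D_2,S]]$. Greedy with Random Discard: take a maximum edge-weight matching of $G[D_1,S]$ and discard each of its edges independently with probability $\frac12$; the remaining edges form $M_1$. In the second stage output a maximum edge-weight matching between $\tilde D_2$ and the supply vertices unmatched by $M_1$.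
   Formalization: The edge weights $w_e$ and the availability probabilities $\pi_i$ are rational numbers. -}

module Defs where

open import Data.Nat using (ℕ; zero; suc)
open import Data.Fin using (Fin)
open import Data.Fin.Properties using () renaming (_≟_ to _≟ᶠ_)
open import Data.Bool using (Bool; true; false; if_then_else_; not; _∧_)
open import Data.Maybe using (Maybe; just; nothing)
open import Data.Sum using (_⊎_; inj₁; inj₂)
open import Data.List using (List; []; _∷_; map; _++_; foldr; concatMap)
open import Data.Bool.ListAction using (any)
open import Data.List.Base using (allFin)
open import Data.Rational using (ℚ; 0ℚ; 1ℚ; ½; _+_; _*_; _-_; _≤_)
open import Relation.Nullary.Decidable using (⌊_⌋)
open import Relation.Binary.PropositionalEquality using (_≡_)

sumℚ : List ℚ → ℚ
sumℚ = foldr _+_ 0ℚ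

allBoolVecs : (n : ℕ) → List (Fin n → Bool)
allBoolVecs zero = (λ ()) ∷ []
allBoolVecs (suc n) =
  concatMap (λ f → (λ { Fin.zero → true ; (Fin.suc i) → f i })
                 ∷ (λ { Fin.zero → false ; (Fin.suc i) → f i }) ∷ [])
            (allBoolVecs n)

halfPow : ℕ → ℚ
halfPow zero = 1ℚ
halfPow (suc n) = ½ * halfPow n

productℚ : List ℚ → ℚ
productℚ = foldr _*_ 1ℚ

-- Bipartite graphs: demand vertices D = D₁ ⊎ D₂, supply vertices S

Dem : ℕ → ℕ → Set
Dem n₁ n₂ = Fin n₁ ⊎ Fin n₂

allDem : (n₁ n₂ : ℕ) → List (Dem n₁ n₂)
allDem n₁ n₂ = map inj₁ (allFin n₁) ++ map inj₂ (allFin n₂)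

isD₁ : ∀ {n₁ n₂} → Dem n₁ n₂ → Bool
isD₁ (inj₁ _) = true
isD₁ (inj₂ _) = false

-- A (partial) assignment of demand vertices to supply vertices;
-- m d ≡ just s means the edge (d , s) is in the matching.
Assignment : ℕ → ℕ → ℕ → Set
Assignment n₁ n₂ nS = Dem n₁ n₂ → Maybe (Fin nS)

-- m is a matching of the subgraph of G (edge set given by adj) induced
-- by the demand vertices with allowedD ≡ true and supply vertices with
-- allowedS ≡ true: every pair is an edge between allowed vertices and
-- no supply vertex is used twice.
record IsMatching {n₁ n₂ nS : ℕ}
    (adj : Dem n₁ n₂ → Fin nS → Bool)
    (allowedD : Dem n₁ n₂ → Bool) (allowedS : Fin nS → Bool)
    (m : Assignment n₁ n₂ nS) : Set where
  field
    isEdge    : ∀ d s → m d ≡ just s → adj d s ≡ true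
    okDemand  : ∀ d s → m d ≡ just s → allowedD d ≡ true
    okSupply  : ∀ d s → m d ≡ just s → allowedS s ≡ true
    injective : ∀ d d′ s → m d ≡ just s → m d′ ≡ just s → d ≡ d′

weight : ∀ {n₁ n₂ nS} → (Dem n₁ n₂ → Fin nS → ℚ) → Assignment n₁ n₂ nS → ℚ
weight {n₁} {n₂} w m = sumℚ (map f (allDem n₁ n₂))
  where
  f : _ → ℚ
  f d with m d
  ... | just s  = w d s
  ... | nothing = 0ℚ

record IsMaxMatching {n₁ n₂ nS : ℕ}
    (adj : Dem n₁ n₂ → Fin nS → Bool) (w : Dem n₁ n₂ → Fin nS → ℚ)
    (allowedD : Dem n₁ n₂ → Bool) (allowedS : Fin nS → Bool)
    (m : Assignment n₁ n₂ nS) : Set where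
  field
    matching : IsMatching adj allowedD allowedS m
    maximum  : ∀ m′ → IsMatching adj allowedD allowedS m′ → weight w m′ ≤ weight w m

allSupply : ∀ {nS} → Fin nS → Bool
allSupply _ = true

presentD : ∀ {n₁ n₂} → (Fin n₂ → Bool) → Dem n₁ n₂ → Bool
presentD a (inj₁ _) = true
presentD a (inj₂ j) = a j

availableD₂ : ∀ {n₁ n₂} → (Fin n₂ → Bool) → Dem n₁ n₂ → Bool
availableD₂ a (inj₁ _) = false
availableD₂ a (inj₂ j) = a j

-- First-stage matching M₁: the edge of M* at i ∈ D₁ is kept iff coin c i ≡ true
-- (each coin is fair, so each edge is discarded independently w.p. ½).
keep : ∀ {n₁ n₂ nS} → Assignment n₁ n₂ nS → (Fin n₁ → Bool) → Assignment n₁ n₂ nS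
keep M* c (inj₁ i) = if c i then M* (inj₁ i) else nothing
keep M* c (inj₂ j) = nothing

sameSupply : ∀ {nS} → Maybe (Fin nS) → Fin nS → Bool
sameSupply (just s′) s = ⌊ s′ ≟ᶠ s ⌋
sameSupply nothing   s = false

unmatchedS : ∀ {n₁ n₂ nS} → Assignment n₁ n₂ nS → Fin nS → Bool
unmatchedS {n₁} {n₂} m s = not (any (λ d → sameSupply (m d) s) (allDem n₁ n₂))

-- Probability of an availability outcome a (independent, Pr[a j] = π j).
probAvail : ∀ {n₂} → (Fin n₂ → ℚ) → (Fin n₂ → Bool) → ℚ
probAvail {n₂} π a = productℚ (map (λ j → if a j then π j else 1ℚ - π j) (allFin n₂))

-- Expected total weight of Greedy with Random Discard, where M* is the
-- first-stage maximum matching and M₂ c a the second-stage matching chosen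
-- for coins c and availability a.
algValue : ∀ {n₁ n₂ nS} → (w : Dem n₁ n₂ → Fin nS → ℚ) → (π : Fin n₂ → ℚ)
  → (M* : Assignment n₁ n₂ nS)
  → (M₂ : (Fin n₁ → Bool) → (Fin n₂ → Bool) → Assignment n₁ n₂ nS) → ℚ
algValue {n₁} {n₂} w π M* M₂ =
  sumℚ (map (λ c → sumℚ (map (λ a →
      (halfPow n₁ * probAvail π a) * (weight w (keep M* c) + weight w (M₂ c a)))
    (allBoolVecs n₂))) (allBoolVecs n₁))

-- OPT_offline, where Mopt a is a maximum matching of G[D₁ ∪ D̃₂, S].
optValue : ∀ {n₁ n₂ nS} → (w : Dem n₁ n₂ → Fin nS → ℚ) → (π : Fin n₂ → ℚ)
  → (Mopt : (Fin n₂ → Bool) → Assignment n₁ n₂ nS) → ℚ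
optValue {n₁} {n₂} w π Mopt =
  sumℚ (map (λ a → probAvail π a * weight w (Mopt a)) (allBoolVecs n₂))

{-# OPTIONS --safe #-}
module Submission where

-- Couple the coin vector c with its complement c̄, which is equally likely.  The kept halves
-- M₁(c) and M₁(c̄) partition M*, so their weights add up to w(M*), which bounds the D₁-part of
-- any offline matching.  Every supply vertex is left free by M₁(c) or by M₁(c̄) (it has at most
-- one M*-partner), so the D₂-part of the offline matching splits between the two second stages,
-- each of which is a feasible competitor of M₂.  Hence the outcomes for c and c̄ together
-- dominate the offline optimum, and averaging over c gives the factor ½.

open import Defs
open import Function using (_∘_; case_of_)
open import Data.Nat using (ℕ; zero; suc)
open import Data.Fin using (Fin; zero; suc)
open import Data.Bool using (Bool; true; false; not; T; if_then_else_)
open import Data.Bool.ListAction using (any; or)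
open import Data.Maybe using (Maybe; just; nothing)
open import Data.List using (List; []; _∷_; map; concatMap; allFin)
open import Data.List.Properties using (map-cong)
open import Data.List.Relation.Unary.Any using (satisfied)
open import Data.List.Relation.Unary.Any.Properties using (any⁻)
open import Data.Product using (∃-syntax; _×_; _,_; proj₁; proj₂)
open import Data.Sum using (_⊎_; inj₁; inj₂)
open import Data.Empty using (⊥; ⊥-elim)
open import Data.Rational using (ℚ; 0ℚ; 1ℚ; ½; _+_; _*_; _-_; -_; _≤_)
open import Data.Rational.Base using (nonNegative)
import Data.Rational.Properties as ℚ
open import Algebra.Bundles using (CommutativeMonoid)
open import Algebra.Properties.CommutativeSemigroup
  (CommutativeMonoid.commutativeSemigroup ℚ.+-0-commutativeMonoid) using (interchange)
open import Relation.Nullary.Decidable using (toWitness)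
open import Relation.Binary.PropositionalEquality

*-nonNeg : ∀ {p q} → 0ℚ ≤ p → 0ℚ ≤ q → 0ℚ ≤ p * q
*-nonNeg {p} {q} 0≤p 0≤q =
  ℚ.nonNegative⁻¹ _ {{ℚ.nonNeg*nonNeg⇒nonNeg p {{nonNegative 0≤p}} q {{nonNegative 0≤q}}}}

*-monoʳ-≤-nonNeg : ∀ {r p q} → 0ℚ ≤ r → p ≤ q → r * p ≤ r * q
*-monoʳ-≤-nonNeg {r} 0≤r = ℚ.*-monoˡ-≤-nonNeg r {{nonNegative 0≤r}}

p≤p+q : ∀ p {q} → 0ℚ ≤ q → p ≤ p + q
p≤p+q p {q} 0≤q = subst (_≤ p + q) (ℚ.+-identityʳ p) (ℚ.+-monoʳ-≤ p 0≤q)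

p≤1⇒0≤1-p : ∀ {p} → p ≤ 1ℚ → 0ℚ ≤ 1ℚ - p
p≤1⇒0≤1-p {p} p≤1 = subst (_≤ 1ℚ - p) (ℚ.+-inverseʳ p) (ℚ.+-monoˡ-≤ (- p) p≤1)

½p+½p≡p : ∀ p → ½ * p + ½ * p ≡ p
½p+½p≡p p = trans (sym (ℚ.*-distribʳ-+ p ½ ½)) (ℚ.*-identityˡ p)

∑ : ∀ {A : Set} → List A → (A → ℚ) → ℚ
∑ xs f = sumℚ (map f xs)

syntax ∑ xs (λ x → e) = ∑[ x ∈ xs ] e

module _ {A : Set} where

  ∑-cong : ∀ {f g : A → ℚ} → f ≗ g → ∀ xs → ∑ xs f ≡ ∑ xs g
  ∑-cong f≗g xs = cong sumℚ (map-cong f≗g xs)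

  ∑-mono : ∀ {f g : A → ℚ} → (∀ x → f x ≤ g x) → ∀ xs → ∑ xs f ≤ ∑ xs g
  ∑-mono f≤g []       = ℚ.≤-refl
  ∑-mono f≤g (x ∷ xs) = ℚ.+-mono-≤ (f≤g x) (∑-mono f≤g xs)

  ∑-+ : ∀ (f g : A → ℚ) xs → ∑[ x ∈ xs ] (f x + g x) ≡ ∑ xs f + ∑ xs g
  ∑-+ f g []       = sym (ℚ.+-identityʳ 0ℚ)
  ∑-+ f g (x ∷ xs) = trans (cong (f x + g x +_) (∑-+ f g xs)) (interchange (f x) (g x) _ _)

  ∑-*ˡ : ∀ k (f : A → ℚ) xs → ∑[ x ∈ xs ] (k * f x) ≡ k * ∑ xs f
  ∑-*ˡ k f []       = sym (ℚ.*-zeroʳ k)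
  ∑-*ˡ k f (x ∷ xs) =
    trans (cong (k * f x +_) (∑-*ˡ k f xs)) (sym (ℚ.*-distribˡ-+ k (f x) _))

  ∑-weighted-≤-+ : ∀ {p g f₁ f₂ : A → ℚ} → (∀ x → 0ℚ ≤ p x) → (∀ x → g x ≤ f₁ x + f₂ x) →
    ∀ xs → ∑[ x ∈ xs ] (p x * g x) ≤ ∑[ x ∈ xs ] (p x * f₁ x) + ∑[ x ∈ xs ] (p x * f₂ x)
  ∑-weighted-≤-+ {p} {g} {f₁} {f₂} 0≤p g≤f₁+f₂ xs = begin
      ∑[ x ∈ xs ] (p x * g x)
    ≤⟨ ∑-mono (λ x → *-monoʳ-≤-nonNeg (0≤p x) (g≤f₁+f₂ x)) xs ⟩
      ∑[ x ∈ xs ] (p x * (f₁ x + f₂ x))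
    ≡⟨ ∑-cong (λ x → ℚ.*-distribˡ-+ (p x) (f₁ x) (f₂ x)) xs ⟩
      ∑[ x ∈ xs ] (p x * f₁ x + p x * f₂ x)
    ≡⟨ ∑-+ (λ x → p x * f₁ x) (λ x → p x * f₂ x) xs ⟩
      ∑[ x ∈ xs ] (p x * f₁ x) + ∑[ x ∈ xs ] (p x * f₂ x)
    ∎
    where open ℚ.≤-Reasoning

  productℚ-nonNeg : ∀ {f : A → ℚ} → (∀ x → 0ℚ ≤ f x) → ∀ xs → 0ℚ ≤ productℚ (map f xs)
  productℚ-nonNeg 0≤f []       = ℚ.nonNegative⁻¹ 1ℚ
  productℚ-nonNeg 0≤f (x ∷ xs) = *-nonNeg (0≤f x) (productℚ-nonNeg 0≤f xs)

∑-pairs : ∀ {A B : Set} (h : B → ℚ) {t f : A → B} xs →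
  ∑ (concatMap (λ x → t x ∷ f x ∷ []) xs) h ≡ ∑[ x ∈ xs ] (h (t x) + h (f x))
∑-pairs h []               = refl
∑-pairs h {t} {f} (x ∷ xs) =
  trans (sym (ℚ.+-assoc (h (t x)) (h (f x)) _)) (cong (h (t x) + h (f x) +_) (∑-pairs h xs))

_◂_ : ∀ {n} → Bool → (Fin n → Bool) → Fin (suc n) → Bool
(b ◂ c) zero    = b
(b ◂ c) (suc i) = c i

◂-cong : ∀ {n} b {c c′ : Fin n → Bool} → c ≗ c′ → (b ◂ c) ≗ (b ◂ c′)
◂-cong b c≗c′ zero    = refl
◂-cong b c≗c′ (suc i) = c≗c′ i

complement : ∀ {n} → (Fin n → Bool) → Fin n → Bool
complement c i = not (c i)

complement-◂ : ∀ {n} b (c : Fin n → Bool) → complement (b ◂ c) ≗ (not b ◂ complement c)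
complement-◂ b c zero    = refl
complement-◂ b c (suc i) = refl

Extensional : ∀ {n} → ((Fin n → Bool) → ℚ) → Set
Extensional h = ∀ {c c′} → c ≗ c′ → h c ≡ h c′

∑-allBoolVecs-suc : ∀ n (h : (Fin (suc n) → Bool) → ℚ) → Extensional h →
  ∑ (allBoolVecs (suc n)) h ≡ ∑[ c ∈ allBoolVecs n ] (h (true ◂ c) + h (false ◂ c))
∑-allBoolVecs-suc n h ext = trans (∑-pairs h (allBoolVecs n))
  (∑-cong (λ c → cong₂ _+_ (ext λ { zero → refl ; (suc i) → refl })
                           (ext λ { zero → refl ; (suc i) → refl })) (allBoolVecs n))

∑-complement : ∀ n (h : (Fin n → Bool) → ℚ) → Extensional h →
  ∑ (allBoolVecs n) (h ∘ complement) ≡ ∑ (allBoolVecs n) h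
∑-complement zero    h ext = cong (_+ 0ℚ) (ext λ ())
∑-complement (suc n) h ext = begin
    ∑ (allBoolVecs (suc n)) (h ∘ complement)
  ≡⟨ ∑-allBoolVecs-suc n (h ∘ complement) (λ c≗c′ → ext (cong not ∘ c≗c′)) ⟩
    ∑[ c ∈ allBoolVecs n ] (h (complement (true ◂ c)) + h (complement (false ◂ c)))
  ≡⟨ ∑-cong swap (allBoolVecs n) ⟩
    ∑ (allBoolVecs n) (H ∘ complement)
  ≡⟨ ∑-complement n H H-ext ⟩
    ∑ (allBoolVecs n) H
  ≡⟨ ∑-allBoolVecs-suc n h ext ⟨
    ∑ (allBoolVecs (suc n)) h
  ∎
  where
  open ≡-Reasoning
  H : (Fin n → Bool) → ℚ
  H c = h (true ◂ c) + h (false ◂ c)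
  H-ext : Extensional H
  H-ext c≗c′ = cong₂ _+_ (ext (◂-cong true c≗c′)) (ext (◂-cong false c≗c′))
  swap : ∀ c → h (complement (true ◂ c)) + h (complement (false ◂ c)) ≡ H (complement c)
  swap c = trans (ℚ.+-comm (h (complement (true ◂ c))) (h (complement (false ◂ c))))
    (cong₂ _+_ (ext (complement-◂ false c)) (ext (complement-◂ true c)))

halfPow-nonNeg : ∀ n → 0ℚ ≤ halfPow n
halfPow-nonNeg zero    = ℚ.nonNegative⁻¹ 1ℚ
halfPow-nonNeg (suc n) = *-nonNeg (ℚ.nonNegative⁻¹ ½) (halfPow-nonNeg n)

mean : ∀ n → ((Fin n → Bool) → ℚ) → ℚ
mean n f = ∑[ c ∈ allBoolVecs n ] (halfPow n * f c)

mean-const : ∀ n p → mean n (λ _ → p) ≡ p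
mean-const zero    p = trans (ℚ.+-identityʳ _) (ℚ.*-identityˡ p)
mean-const (suc n) p = begin
    ∑[ c ∈ allBoolVecs (suc n) ] (½ * halfPow n * p)
  ≡⟨ ∑-pairs (λ _ → ½ * halfPow n * p) (allBoolVecs n) ⟩
    ∑[ c ∈ allBoolVecs n ] (½ * halfPow n * p + ½ * halfPow n * p)
  ≡⟨ ∑-cong (λ _ → halve) (allBoolVecs n) ⟩
    mean n (λ _ → p)
  ≡⟨ mean-const n p ⟩
    p
  ∎
  where
  open ≡-Reasoning
  halve : ½ * halfPow n * p + ½ * halfPow n * p ≡ halfPow n * p
  halve = trans (cong₂ _+_ (ℚ.*-assoc ½ (halfPow n) p) (ℚ.*-assoc ½ (halfPow n) p))
                (½p+½p≡p (halfPow n * p))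

mean-mono : ∀ n {f g : (Fin n → Bool) → ℚ} → (∀ c → f c ≤ g c) → mean n f ≤ mean n g
mean-mono n f≤g = ∑-mono (λ c → *-monoʳ-≤-nonNeg (halfPow-nonNeg n) (f≤g c)) (allBoolVecs n)

mean-+ : ∀ n (f g : (Fin n → Bool) → ℚ) → mean n (λ c → f c + g c) ≡ mean n f + mean n g
mean-+ n f g = trans (∑-cong (λ c → ℚ.*-distribˡ-+ (halfPow n) (f c) (g c)) (allBoolVecs n))
                     (∑-+ (λ c → halfPow n * f c) (λ c → halfPow n * g c) (allBoolVecs n))

mean-complement : ∀ n (f : (Fin n → Bool) → ℚ) → Extensional f →
  mean n (f ∘ complement) ≡ mean n f
mean-complement n f ext = ∑-complement n (λ c → halfPow n * f c) (cong (halfPow n *_) ∘ ext)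

½≤mean-of-complementary : ∀ n {f : (Fin n → Bool) → ℚ} {p} → Extensional f →
  (∀ c → p ≤ f c + f (complement c)) → ½ * p ≤ mean n f
½≤mean-of-complementary n {f} {p} ext p≤f+f̄ = begin
    ½ * p                                        ≡⟨ cong (½ *_) (mean-const n p) ⟨
    ½ * mean n (λ _ → p)                         ≤⟨ ℚ.*-monoˡ-≤-nonNeg ½ (mean-mono n p≤f+f̄) ⟩
    ½ * mean n (λ c → f c + f (complement c))    ≡⟨ cong (½ *_) (mean-+ n f (f ∘ complement)) ⟩
    ½ * (mean n f + mean n (f ∘ complement))     ≡⟨ cong (λ x → ½ * (mean n f + x))
                                                         (mean-complement n f ext) ⟩
    ½ * (mean n f + mean n f)                    ≡⟨ ℚ.*-distribˡ-+ ½ (mean n f) (mean n f) ⟩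
    ½ * mean n f + ½ * mean n f                  ≡⟨ ½p+½p≡p (mean n f) ⟩
    mean n f                                     ∎
  where open ℚ.≤-Reasoning

probAvail-nonNeg : ∀ {n₂} {π : Fin n₂ → ℚ} → (∀ j → 0ℚ ≤ π j) → (∀ j → π j ≤ 1ℚ) →
  ∀ a → 0ℚ ≤ probAvail π a
probAvail-nonNeg {n₂} {π} 0≤π π≤1 a = productℚ-nonNeg factor-nonNeg (allFin n₂)
  where
  factor-nonNeg : ∀ j → 0ℚ ≤ (if a j then π j else 1ℚ - π j)
  factor-nonNeg j with a j
  ... | true  = 0≤π j
  ... | false = p≤1⇒0≤1-p (π≤1 j)

¬T∧T-not : ∀ b → T b → T (not b) → ⊥
¬T∧T-not true _ ()

not-or-not : ∀ {a b : Bool} → (T a → T b → ⊥) → not a ≡ true ⊎ not b ≡ true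
not-or-not {false}        _ = inj₁ refl
not-or-not {true} {false} _ = inj₂ refl
not-or-not {true} {true}  h = ⊥-elim (h _ _)

retainIf : ∀ {nS} → (Fin nS → Bool) → Maybe (Fin nS) → Maybe (Fin nS)
retainIf u nothing  = nothing
retainIf u (just s) = if u s then just s else nothing

retainIf-just : ∀ {nS} (u : Fin nS → Bool) x {s} →
  retainIf u x ≡ just s → x ≡ just s × u s ≡ true
retainIf-just u (just s′) e with u s′ in us′
retainIf-just u (just s′) refl | true = refl , us′

retainIf-cong : ∀ {nS} {u u′ : Fin nS → Bool} → u ≗ u′ → ∀ x → retainIf u x ≡ retainIf u′ x
retainIf-cong u≗u′ nothing  = refl
retainIf-cong u≗u′ (just s) = cong (λ b → if b then just s else nothing) (u≗u′ s)

module _ {n₁ n₂ nS : ℕ} where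

  onD₁ onD₂ : Assignment n₁ n₂ nS → Assignment n₁ n₂ nS
  onD₁ m (inj₁ i) = m (inj₁ i)
  onD₁ m (inj₂ j) = nothing
  onD₂ m (inj₁ i) = nothing
  onD₂ m (inj₂ j) = m (inj₂ j)

  restrictSupply : (Fin nS → Bool) → Assignment n₁ n₂ nS → Assignment n₁ n₂ nS
  restrictSupply u m = retainIf u ∘ m

  _⊆_ : Assignment n₁ n₂ nS → Assignment n₁ n₂ nS → Set
  m′ ⊆ m = ∀ {d s} → m′ d ≡ just s → m d ≡ just s

  module _ {adj : Dem n₁ n₂ → Fin nS → Bool} where

    ⊆-isMatching : ∀ {A A′ S S′} {m m′ : Assignment n₁ n₂ nS} → m′ ⊆ m → IsMatching adj A S m →
      (∀ d s → m′ d ≡ just s → A′ d ≡ true) → (∀ d s → m′ d ≡ just s → S′ s ≡ true) →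
      IsMatching adj A′ S′ m′
    ⊆-isMatching m′⊆m M okDemand okSupply = record
      { isEdge    = λ d s e → IsMatching.isEdge M d s (m′⊆m e)
      ; okDemand  = okDemand
      ; okSupply  = okSupply
      ; injective = λ d d′ s e e′ → IsMatching.injective M d d′ s (m′⊆m e) (m′⊆m e′)
      }

    onD₁-isMatching : ∀ {A S m} → IsMatching adj A S m → IsMatching adj isD₁ allSupply (onD₁ m)
    onD₁-isMatching {m = m} M = ⊆-isMatching onD₁-⊆ M onD₁-demand (λ _ _ _ → refl)
      where
      onD₁-⊆ : onD₁ m ⊆ m
      onD₁-⊆ {d = inj₁ i} e = e
      onD₁-demand : ∀ d s → onD₁ m d ≡ just s → isD₁ d ≡ true
      onD₁-demand (inj₁ i) s _ = refl

    onD₂-isMatching : ∀ {a S m} → IsMatching adj (presentD a) S m →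
      IsMatching adj (availableD₂ a) S (onD₂ m)
    onD₂-isMatching {m = m} M =
      ⊆-isMatching onD₂-⊆ M onD₂-demand (λ d s → IsMatching.okSupply M d s ∘ onD₂-⊆)
      where
      onD₂-⊆ : onD₂ m ⊆ m
      onD₂-⊆ {d = inj₂ j} e = e
      onD₂-demand : ∀ d s → onD₂ m d ≡ just s → availableD₂ _ d ≡ true
      onD₂-demand (inj₂ j) s = IsMatching.okDemand M (inj₂ j) s

    restrictSupply-isMatching : ∀ {A S} u {m} → IsMatching adj A S m →
      IsMatching adj A u (restrictSupply u m)
    restrictSupply-isMatching u {m} M = ⊆-isMatching (λ {d} → proj₁ ∘ retainIf-just u (m d)) M
      (λ d s → IsMatching.okDemand M d s ∘ proj₁ ∘ retainIf-just u (m d))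
      (λ d s → proj₂ ∘ retainIf-just u (m d))

  keep-cong : ∀ (M : Assignment n₁ n₂ nS) {c c′} → c ≗ c′ → keep M c ≗ keep M c′
  keep-cong M c≗c′ (inj₁ i) = cong (λ b → if b then M (inj₁ i) else nothing) (c≗c′ i)
  keep-cong M c≗c′ (inj₂ j) = refl

  unmatchedS-cong : ∀ {m m′ : Assignment n₁ n₂ nS} → m ≗ m′ → unmatchedS m ≗ unmatchedS m′
  unmatchedS-cong m≗m′ s =
    cong (not ∘ or) (map-cong (λ d → cong (λ x → sameSupply x s) (m≗m′ d)) (allDem n₁ n₂))

  matched-keep : ∀ (M : Assignment n₁ n₂ nS) c d s → T (sameSupply (keep M c d) s) →
    ∃[ i ] T (c i) × M (inj₁ i) ≡ just s
  matched-keep M c (inj₁ i) s t with c i in ci | M (inj₁ i) in Mi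
  ... | true | just s′ = i , subst T (sym ci) _ , trans Mi (cong just (toWitness t))

  -- A supply vertex matched under both c and its complement would be the partner of a
  -- single i ∈ D₁ (M is injective) whose coin shows both values.
  unmatched-keep-or-complement : ∀ {adj A S} {M : Assignment n₁ n₂ nS} → IsMatching adj A S M →
    ∀ c s → unmatchedS (keep M c) s ≡ true ⊎ unmatchedS (keep M (complement c)) s ≡ true
  unmatched-keep-or-complement {M = M} M-matching c s = not-or-not matched-both
    where
    matched-both : T (any (λ d → sameSupply (keep M c d) s) (allDem n₁ n₂)) →
                   T (any (λ d → sameSupply (keep M (complement c) d) s) (allDem n₁ n₂)) → ⊥
    matched-both t t′
      with satisfied (any⁻ _ (allDem n₁ n₂) t) | satisfied (any⁻ _ (allDem n₁ n₂) t′)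
    ... | d , e | d′ , e′ with matched-keep M c d s e | matched-keep M (complement c) d′ s e′
    ... | i , ci , Mi | i′ , c̄i′ , Mi′ with IsMatching.injective M-matching _ _ s Mi Mi′
    ... | refl = ¬T∧T-not (c i) ci c̄i′

-- Defs keeps the summand of weight local to a where block; it is recovered from the type of refl.
summandOf : ∀ {A : Set} {xs : List A} {f : A → ℚ} {q} → sumℚ (map f xs) ≡ q → A → ℚ
summandOf {f = f} _ = f

module _ {n₁ n₂ nS : ℕ} (w : Dem n₁ n₂ → Fin nS → ℚ) where

  edgeWeight : Dem n₁ n₂ → Maybe (Fin nS) → ℚ
  edgeWeight d (just s) = w d s
  edgeWeight d nothing  = 0ℚ

  weight-summand : ∀ m →
    summandOf {xs = allDem n₁ n₂} (refl {x = weight w m}) ≗ λ d → edgeWeight d (m d)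
  weight-summand m d with m d
  ... | just s  = refl
  ... | nothing = refl

  weight-unfold : ∀ m → weight w m ≡ ∑[ d ∈ allDem n₁ n₂ ] edgeWeight d (m d)
  weight-unfold m = ∑-cong (weight-summand m) (allDem n₁ n₂)

  weight-cong : ∀ {m m′} → m ≗ m′ → weight w m ≡ weight w m′
  weight-cong {m} {m′} m≗m′ = trans (weight-unfold m)
    (trans (∑-cong (λ d → cong (edgeWeight d) (m≗m′ d)) (allDem n₁ n₂)) (sym (weight-unfold m′)))

  weight-+ : ∀ m₁ m₂ → weight w m₁ + weight w m₂ ≡
    ∑[ d ∈ allDem n₁ n₂ ] (edgeWeight d (m₁ d) + edgeWeight d (m₂ d))
  weight-+ m₁ m₂ = trans (cong₂ _+_ (weight-unfold m₁) (weight-unfold m₂))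
    (sym (∑-+ (λ d → edgeWeight d (m₁ d)) (λ d → edgeWeight d (m₂ d)) (allDem n₁ n₂)))

  weight-≡-+ : ∀ m m₁ m₂ →
    (∀ d → edgeWeight d (m d) ≡ edgeWeight d (m₁ d) + edgeWeight d (m₂ d)) →
    weight w m ≡ weight w m₁ + weight w m₂
  weight-≡-+ m m₁ m₂ split =
    trans (weight-unfold m) (trans (∑-cong split (allDem n₁ n₂)) (sym (weight-+ m₁ m₂)))

  weight-≤-+ : ∀ m m₁ m₂ →
    (∀ d → edgeWeight d (m d) ≤ edgeWeight d (m₁ d) + edgeWeight d (m₂ d)) →
    weight w m ≤ weight w m₁ + weight w m₂
  weight-≤-+ m m₁ m₂ le =
    subst₂ _≤_ (sym (weight-unfold m)) (sym (weight-+ m₁ m₂)) (∑-mono le (allDem n₁ n₂))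

  weight-onD₁-onD₂ : ∀ m → weight w m ≡ weight w (onD₁ m) + weight w (onD₂ m)
  weight-onD₁-onD₂ m = weight-≡-+ m (onD₁ m) (onD₂ m) λ
    { (inj₁ i) → sym (ℚ.+-identityʳ _)
    ; (inj₂ j) → sym (ℚ.+-identityˡ _) }

  weight-keep-complement : ∀ {adj S} {M : Assignment n₁ n₂ nS} → IsMatching adj isD₁ S M →
    ∀ c → weight w M ≡ weight w (keep M c) + weight w (keep M (complement c))
  weight-keep-complement {M = M} M-matching c =
    weight-≡-+ M (keep M c) (keep M (complement c)) split
    where
    split : ∀ d →
      edgeWeight d (M d) ≡ edgeWeight d (keep M c d) + edgeWeight d (keep M (complement c) d)
    split (inj₁ i) with c i
    ... | true  = sym (ℚ.+-identityʳ _)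
    ... | false = sym (ℚ.+-identityˡ _)
    split (inj₂ j) with M (inj₂ j) in e
    ... | nothing = sym (ℚ.+-identityʳ 0ℚ)
    ... | just s  = case IsMatching.okDemand M-matching (inj₂ j) s e of λ ()

  weight-≤-restrictSupply-cover : (∀ d s → 0ℚ ≤ w d s) →
    ∀ {u u′} → (∀ s → u s ≡ true ⊎ u′ s ≡ true) →
    ∀ m → weight w m ≤ weight w (restrictSupply u m) + weight w (restrictSupply u′ m)
  weight-≤-restrictSupply-cover 0≤w {u} {u′} cover m =
    weight-≤-+ m (restrictSupply u m) (restrictSupply u′ m) (λ d → covered d (m d))
    where
    edgeWeight-nonNeg : ∀ d x → 0ℚ ≤ edgeWeight d x
    edgeWeight-nonNeg d (just s) = 0≤w d s
    edgeWeight-nonNeg d nothing  = ℚ.≤-refl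
    covered : ∀ d x →
      edgeWeight d x ≤ edgeWeight d (retainIf u x) + edgeWeight d (retainIf u′ x)
    covered d nothing = ℚ.≤-refl
    covered d (just s) with u s | u′ s | cover s
    ... | true  | b     | _       = p≤p+q (w d s) (edgeWeight-nonNeg d (if b then just s else nothing))
    ... | false | true  | _       = ℚ.≤-reflexive (sym (ℚ.+-identityˡ (w d s)))
    ... | false | false | inj₁ ()
    ... | false | false | inj₂ ()

algValue-≡-mean : ∀ {n₁ n₂ nS} w π (M* : Assignment n₁ n₂ nS) M₂ → algValue w π M* M₂ ≡
  mean n₁ (λ c → ∑[ a ∈ allBoolVecs n₂ ]
                   (probAvail π a * (weight w (keep M* c) + weight w (M₂ c a))))
algValue-≡-mean {n₁} {n₂} w π M* M₂ = ∑-cong rearrange (allBoolVecs n₁)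
  where
  value : (Fin n₁ → Bool) → (Fin n₂ → Bool) → ℚ
  value c a = weight w (keep M* c) + weight w (M₂ c a)
  rearrange : ∀ c → ∑[ a ∈ allBoolVecs n₂ ] (halfPow n₁ * probAvail π a * value c a)
                  ≡ halfPow n₁ * ∑[ a ∈ allBoolVecs n₂ ] (probAvail π a * value c a)
  rearrange c = trans (∑-cong (λ a → ℚ.*-assoc (halfPow n₁) (probAvail π a) _) (allBoolVecs n₂))
                      (∑-*ˡ (halfPow n₁) _ (allBoolVecs n₂))

module GreedyWithRandomDiscard {n₁ n₂ nS : ℕ} {adj : Dem n₁ n₂ → Fin nS → Bool}
    {w : Dem n₁ n₂ → Fin nS → ℚ} (0≤w : ∀ d s → 0ℚ ≤ w d s)
    {M* : Assignment n₁ n₂ nS} (M*-max : IsMaxMatching adj w isD₁ allSupply M*) where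

  remnant : Assignment n₁ n₂ nS → (Fin n₁ → Bool) → Assignment n₁ n₂ nS
  remnant m c = restrictSupply (unmatchedS (keep M* c)) (onD₂ m)

  -- With coins c the second stage can still use the remnant of any offline matching m.
  guaranteedValue : Assignment n₁ n₂ nS → (Fin n₁ → Bool) → ℚ
  guaranteedValue m c = weight w (keep M* c) + weight w (remnant m c)

  guaranteedValue-≤ : ∀ {a S m m₂ c} → IsMatching adj (presentD a) S m →
    IsMaxMatching adj w (availableD₂ a) (unmatchedS (keep M* c)) m₂ →
    guaranteedValue m c ≤ weight w (keep M* c) + weight w m₂
  guaranteedValue-≤ {c = c} m-matching m₂-max = ℚ.+-monoʳ-≤ (weight w (keep M* c))
    (IsMaxMatching.maximum m₂-max _ (restrictSupply-isMatching _ (onD₂-isMatching m-matching)))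

  guaranteedValue-ext : ∀ m → Extensional (guaranteedValue m)
  guaranteedValue-ext m c≗c′ = cong₂ _+_ (weight-cong w (keep-cong M* c≗c′))
    (weight-cong w (retainIf-cong (unmatchedS-cong (keep-cong M* c≗c′)) ∘ onD₂ m))

  weight-≤-guaranteedValue-complement : ∀ {a S m} → IsMatching adj (presentD a) S m →
    ∀ c → weight w m ≤ guaranteedValue m c + guaranteedValue m (complement c)
  weight-≤-guaranteedValue-complement {m = m} m-matching c = begin
      weight w m
    ≡⟨ weight-onD₁-onD₂ w m ⟩
      weight w (onD₁ m) + weight w (onD₂ m)
    ≤⟨ ℚ.+-mono-≤ (IsMaxMatching.maximum M*-max _ (onD₁-isMatching m-matching))
                  (weight-≤-restrictSupply-cover w 0≤w
                     (unmatched-keep-or-complement M*-matching c) (onD₂ m)) ⟩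
      weight w M* + remnants
    ≡⟨ cong (_+ remnants) (weight-keep-complement w M*-matching c) ⟩
      weight w (keep M* c) + weight w (keep M* (complement c)) + remnants
    ≡⟨ interchange (weight w (keep M* c)) _ _ _ ⟩
      guaranteedValue m c + guaranteedValue m (complement c)
    ∎
    where
    open ℚ.≤-Reasoning
    M*-matching : IsMatching adj isD₁ allSupply M*
    M*-matching = IsMaxMatching.matching M*-max
    remnants : ℚ
    remnants = weight w (remnant m c) + weight w (remnant m (complement c))

mainTheorem13 : (n₁ n₂ nS : ℕ)
    (adj : Dem n₁ n₂ → Fin nS → Bool)
    (w : Dem n₁ n₂ → Fin nS → ℚ)
    (π : Fin n₂ → ℚ)
    → (∀ d s → 0ℚ ≤ w d s)
    → (∀ j → 0ℚ ≤ π j)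
    → (∀ j → π j ≤ 1ℚ)
    → (M* : Assignment n₁ n₂ nS)
    → IsMaxMatching adj w isD₁ allSupply M*
    → (M₂ : (Fin n₁ → Bool) → (Fin n₂ → Bool) → Assignment n₁ n₂ nS)
    → (∀ c a → IsMaxMatching adj w (availableD₂ a) (unmatchedS (keep M* c)) (M₂ c a))
    → (Mopt : (Fin n₂ → Bool) → Assignment n₁ n₂ nS)
    → (∀ a → IsMaxMatching adj w (presentD a) allSupply (Mopt a))
    → ½ * optValue w π Mopt ≤ algValue w π M* M₂
mainTheorem13 n₁ n₂ nS adj w π 0≤w 0≤π π≤1 M* M*-max M₂ M₂-max Mopt Mopt-max = begin
    ½ * optValue w π Mopt
  ≤⟨ ½≤mean-of-complementary n₁ guaranteed-ext (λ c → ∑-weighted-≤-+ 0≤P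
       (λ a → weight-≤-guaranteedValue-complement (Mopt-matching a) c) (allBoolVecs n₂)) ⟩
    mean n₁ guaranteed
  ≤⟨ mean-mono n₁ (λ c → ∑-mono (λ a → *-monoʳ-≤-nonNeg (0≤P a)
       (guaranteedValue-≤ (Mopt-matching a) (M₂-max c a))) (allBoolVecs n₂)) ⟩
    mean n₁ (λ c → ∑[ a ∈ allBoolVecs n₂ ]
                     (probAvail π a * (weight w (keep M* c) + weight w (M₂ c a))))
  ≡⟨ algValue-≡-mean w π M* M₂ ⟨
    algValue w π M* M₂
  ∎
  where
  open ℚ.≤-Reasoning
  open GreedyWithRandomDiscard 0≤w M*-max
  0≤P : ∀ a → 0ℚ ≤ probAvail π a
  0≤P = probAvail-nonNeg 0≤π π≤1
  Mopt-matching : ∀ a → IsMatching adj (presentD a) allSupply (Mopt a)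
  Mopt-matching a = IsMaxMatching.matching (Mopt-max a)
  guaranteed : (Fin n₁ → Bool) → ℚ
  guaranteed c = ∑[ a ∈ allBoolVecs n₂ ] (probAvail π a * guaranteedValue (Mopt a) c)
  guaranteed-ext : Extensional guaranteed
  guaranteed-ext c≗c′ =
    ∑-cong (λ a → cong (probAvail π a *_) (guaranteedValue-ext (Mopt a) c≗c′)) (allBoolVecs n₂)
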